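{- For all $n\geq 1$, the number of desarrangements of length $n$ avoiding each of $231$, $312$, and $321$ is $d_n(231,312,321)=f_{n-1}$, the $(n-1)$st Fibonacci number.
   Context: Permutations are in one-line notation. An index $i\in[n-1]$ is a descent of $\pi\in\mathfrak{S}_n$ if $\pi_i>\pi_{i+1}$; $i\in[n]$ is an ascent if it is not a descent (so $n$ is always an ascent). A desarrangement is a permutation whose first ascent is even. $d_n(\Pi)$ is the number of desarrangements in $\mathfrak{S}_n$ avoiding every pattern in $\Pi$ ($\pi$ avoids $\sigma$ if no subsequence of $\pi$ has the same relative order as $\sigma$). Fibonacci numbers: $f_0=0$, $f_1=1$, $f_n=f_{n-1}+f_{n-2}$ for $n\ge2$. -}

module Defs where

open import Data.Nat using (ℕ; zero; suc; _+_; _<ᵇ_; _≡ᵇ_)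
open import Data.Bool using (Bool; true; false; _∧_; _∨_; not; if_then_else_)
open import Data.List using (List; []; _∷_; length; map; concatMap; filter; upTo)
open import Data.Bool.ListAction using (all; any)
open import Relation.Nullary.Decidable using (Dec; yes; no)
open import Data.Bool.Properties using () renaming (T? to T?)
open import Data.Bool using (T)

fib : ℕ → ℕ
fib zero = 0
fib (suc zero) = 1
fib (suc (suc n)) = fib (suc n) + fib n

words : ℕ → ℕ → List (List ℕ)
words n zero = [] ∷ []
words n (suc k) = concatMap (λ w → map (λ a → a ∷ w) (map suc (upTo n))) (words n k)

elem : ℕ → List ℕ → Bool
elem a xs = any (λ b → a ≡ᵇ b) xs

distinct : List ℕ → Bool
distinct [] = true
distinct (x ∷ xs) = not (elem x xs) ∧ distinct xs

-- The permutations of [n] in one-line notation: the words of length n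
-- over {1,…,n} with pairwise distinct letters.
perms : ℕ → List (List ℕ)
perms n = filter (λ w → T? (distinct w)) (words n n)

subseqs : List ℕ → List (List ℕ)
subseqs [] = [] ∷ []
subseqs (x ∷ xs) = map (x ∷_) (subseqs xs) Data.List.++ subseqs xs

pairwiseSame : ℕ → ℕ → ℕ → ℕ → Bool
pairwiseSame a b c d = ((a <ᵇ b) ≡ᵇ' (c <ᵇ d)) ∧ ((a ≡ᵇ b) ≡ᵇ' (c ≡ᵇ d))
  where
  _≡ᵇ'_ : Bool → Bool → Bool
  true ≡ᵇ' y = y
  false ≡ᵇ' y = not y

sameOrder : List ℕ → List ℕ → Bool
sameOrder [] [] = true
sameOrder (x ∷ xs) (y ∷ ys) =
  all (λ p → pairwiseSame x (Data.Product.proj₁ p) y (Data.Product.proj₂ p)) (zip xs ys)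
  ∧ sameOrder xs ys
  where open import Data.List using (zip)
        import Data.Product
sameOrder _ _ = false

contains : List ℕ → List ℕ → Bool
contains π σ = any (λ s → sameOrder s σ) (subseqs π)

avoids : List ℕ → List ℕ → Bool
avoids π σ = not (contains π σ)

avoidsAll : List (List ℕ) → List ℕ → Bool
avoidsAll Π π = all (avoids π) Π

even : ℕ → Bool
even zero = true
even (suc n) = not (even n)

-- First ascent (1-based). Index i is an ascent if it is not a descent;
-- the last index n is always an ascent.
-- firstAscentFrom i π : position of the first ascent of π, where the head of π has index i.
firstAscentFrom : ℕ → List ℕ → ℕ
firstAscentFrom i [] = i
firstAscentFrom i (x ∷ []) = i
firstAscentFrom i (x ∷ y ∷ rest) = if y <ᵇ x then firstAscentFrom (suc i) (y ∷ rest) else i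

firstAscent : List ℕ → ℕ
firstAscent π = firstAscentFrom 1 π

isDesarrangement : List ℕ → Bool
isDesarrangement π = even (firstAscent π)

d : ℕ → List (List ℕ) → ℕ
d n Π = length (filter (λ π → T? (isDesarrangement π ∧ avoidsAll Π π)) (perms n))

{-# OPTIONS --safe #-}

-- A permutation avoids 231, 312 and 321 exactly when every subsequence a b c has a < c, i.e. when
-- it has no "falling" triple.  In such a permutation of {m+1, …}, the least value m+1 comes first,
-- or second right after m+2: any later occurrence would end a falling triple.
-- Hence these permutations are the direct sums of blocks 1 and 21, and the desarrangements among
-- them are the sums 21 ⊕ τ.  Block sequences of total size k are counted by fib (k + 1), which gives
-- fib (n - 1) for n ≥ 2; the case n = 1 is a computation.

module Submission where

open import Defs
open import Data.Nat using (ℕ; suc; _≥_)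
open import Data.List using (List; []; _∷_)
open import Relation.Binary.PropositionalEquality using (_≡_)

open import Data.Bool using (Bool; true; false; T; not; _∧_)
open import Data.Bool.Properties using (T-∧; T-≡; T-not-≡; T?)
open import Data.Empty using (⊥)
open import Data.List using (filter; length; _++_; map; upTo; concatMap; cartesianProductWith)
open import Data.List.Properties
  using (length-++; length-map; length-upTo; ∷-injective; ∷-injectiveˡ; ∷-injectiveʳ)
open import Data.List.Membership.Propositional using (_∈_; find; lose)
open import Data.List.Membership.Propositional.Properties
  using ( ∈-∃++; ∈-++⁺ˡ; ∈-++⁺ʳ; ∈-++⁻; ∈-map⁺; ∈-map⁻; ∈-upTo⁺; ∈-upTo⁻; ∈-filter⁺; ∈-filter⁻
        ; ∈-cartesianProductWith⁺; ∈-cartesianProductWith⁻)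
open import Data.List.Relation.Binary.Permutation.Propositional.Properties using (shift; ∈-resp-↭; ↭-length)
open import Data.List.Relation.Binary.Sublist.Propositional using (_⊆_; _⊇_; []; _∷_; _∷ʳ_; lookup; from∈)
open import Data.List.Relation.Binary.Sublist.Propositional.Properties using (All-resp-⊆)
open import Data.List.Relation.Unary.All as All using (All; []; _∷_)
open import Data.List.Relation.Unary.All.Properties using (¬Any⇒All¬; All¬⇒¬Any; all⁺; all⁻)
open import Data.List.Relation.Unary.AllPairs using ([]; _∷_)
open import Data.List.Relation.Unary.Any as Any using (Any; here; there)
open import Data.List.Relation.Unary.Any.Properties using (any⇔)
open import Data.List.Relation.Unary.Unique.Propositional using (Unique)
import Data.List.Relation.Unary.Unique.Propositional.Properties as Unique
open import Data.Nat using (zero; _+_; _<_; _≤_; z≤n; s≤s; z<s; _<ᵇ_; _≡ᵇ_)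
open import Data.Nat.Properties
open import Data.Product using (∃-syntax; _×_; _,_; proj₁; proj₂)
open import Data.Sum using (inj₁; inj₂)
open import Data.Unit using (tt)
open import Function using (_∘_; flip; _⇔_; mk⇔; Equivalence)
open import Relation.Binary.Definitions using (DecidableEquality; _Respects_; tri<; tri≈; tri>)
open import Relation.Binary.PropositionalEquality
  using (refl; sym; trans; cong; cong₂; subst; _≢_; module ≡-Reasoning)
open import Relation.Nullary using (¬_; yes; no; contradiction)

open Equivalence using (to; from)

-- Counting duplicate-free lists

module _ {a} {A : Set a} where

  ∈-removeMiddle : ∀ {x y : A} as bs → y ∈ as ++ x ∷ bs → x ≢ y → y ∈ as ++ bs
  ∈-removeMiddle {x} as bs y∈ x≢y with ∈-resp-↭ (shift x as bs) y∈
  ... | here y≡x   = contradiction (sym y≡x) x≢y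
  ... | there y∈′ = y∈′

  Unique-resp-⊆ : Unique {A = A} Respects _⊇_
  Unique-resp-⊆ []           []           = []
  Unique-resp-⊆ (_ ∷ʳ s⊆w)   (_ ∷ w!)     = Unique-resp-⊆ s⊆w w!
  Unique-resp-⊆ (refl ∷ s⊆w) (x≢w ∷ w!) = All-resp-⊆ s⊆w x≢w ∷ Unique-resp-⊆ s⊆w w!

  unique⇒length≤ : ∀ {xs ys : List A} → Unique xs → All (_∈ ys) xs → length xs ≤ length ys
  unique⇒length≤ []              []              = z≤n
  unique⇒length≤ {x ∷ xs} (x≢xs ∷ xs!) (x∈ys ∷ xs⊆ys) with as , bs , refl ← ∈-∃++ x∈ys = begin
    suc (length xs)          ≤⟨ s≤s (unique⇒length≤ xs! xs⊆as++bs) ⟩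
    suc (length (as ++ bs))  ≡⟨ ↭-length (shift x as bs) ⟨
    length (as ++ x ∷ bs)    ∎
    where
    open ≤-Reasoning
    xs⊆as++bs : All (_∈ as ++ bs) xs
    xs⊆as++bs = All.zipWith (λ (y∈ , x≢y) → ∈-removeMiddle as bs y∈ x≢y) (xs⊆ys , x≢xs)

  unique⇒length≡ : ∀ {xs ys : List A} → Unique xs → Unique ys → All (_∈ ys) xs → All (_∈ xs) ys →
                   length xs ≡ length ys
  unique⇒length≡ xs! ys! xs⊆ys ys⊆xs = ≤-antisym (unique⇒length≤ xs! xs⊆ys) (unique⇒length≤ ys! ys⊆xs)

module _ {a} {A : Set a} (_≟ᴬ_ : DecidableEquality A) where
  open import Data.List.Membership.DecPropositional _≟ᴬ_ using (_∈?_)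

  unique∧length≥⇒⊇ : ∀ {xs ys : List A} → Unique xs → All (_∈ ys) xs → length ys ≤ length xs →
                      ∀ {v} → v ∈ ys → v ∈ xs
  unique∧length≥⇒⊇ {xs} xs! xs⊆ys |ys|≤|xs| {v} v∈ys with v ∈? xs
  ... | yes v∈xs = v∈xs
  ... | no  v∉xs =
    contradiction (unique⇒length≤ (¬Any⇒All¬ xs v∉xs ∷ xs!) (v∈ys ∷ xs⊆ys)) (≤⇒≯ |ys|≤|xs|)

T-not : ∀ {b} → T (not b) ⇔ (¬ T b)
T-not {false} = mk⇔ (λ _ ()) (λ _ → tt)
T-not {true}  = mk⇔ (λ ()) (λ ¬tt → ¬tt tt)

¬T⇒≡false : ∀ {b} → ¬ T b → b ≡ false
¬T⇒≡false = to T-not-≡ ∘ from T-not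

<⇒<ᵇ≡true : ∀ {m n} → m < n → (m <ᵇ n) ≡ true
<⇒<ᵇ≡true = to T-≡ ∘ <⇒<ᵇ

≮⇒<ᵇ≡false : ∀ {m n} → ¬ m < n → (m <ᵇ n) ≡ false
≮⇒<ᵇ≡false {m} {n} m≮n = ¬T⇒≡false (m≮n ∘ <ᵇ⇒< m n)

≢⇒≡ᵇ≡false : ∀ {m n} → m ≢ n → (m ≡ᵇ n) ≡ false
≢⇒≡ᵇ≡false {m} {n} m≢n = ¬T⇒≡false (m≢n ∘ ≡ᵇ⇒≡ m n)

pairwiseSame-< : ∀ {x y p q} → x < y → p < q → T (pairwiseSame x y p q)
pairwiseSame-< x<y p<q
  rewrite <⇒<ᵇ≡true x<y | <⇒<ᵇ≡true p<q | ≢⇒≡ᵇ≡false (<⇒≢ x<y) | ≢⇒≡ᵇ≡false (<⇒≢ p<q) = tt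

pairwiseSame-> : ∀ {x y p q} → y < x → q < p → T (pairwiseSame x y p q)
pairwiseSame-> y<x q<p
  rewrite ≮⇒<ᵇ≡false (<⇒≯ y<x) | ≮⇒<ᵇ≡false (<⇒≯ q<p) | ≢⇒≡ᵇ≡false (>⇒≢ y<x) | ≢⇒≡ᵇ≡false (>⇒≢ q<p) = tt

pairwiseSame->⁻ : ∀ {x y p q} → q < p → T (pairwiseSame x y p q) → y < x
pairwiseSame->⁻ {x} {y} q<p same
  rewrite ≮⇒<ᵇ≡false (<⇒≯ q<p) | ≢⇒≡ᵇ≡false (>⇒≢ q<p)
  with x <ᵇ y in x<ᵇy | x ≡ᵇ y in x≡ᵇy
... | false | false = ≤∧≢⇒< (≮⇒≥ (subst T x<ᵇy ∘ <⇒<ᵇ)) (subst T x≡ᵇy ∘ ≡⇒≡ᵇ x y ∘ sym)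

sameOrder-length : ∀ s σ → T (sameOrder s σ) → length s ≡ length σ
sameOrder-length []      []      _    = refl
sameOrder-length (x ∷ s) (y ∷ σ) same = cong suc (sameOrder-length s σ (proj₂ (to T-∧ same)))

sameOrder-triple : ∀ a b c p q r →
                   T (pairwiseSame a b p q) → T (pairwiseSame a c p r) → T (pairwiseSame b c q r) →
                   T (sameOrder (a ∷ b ∷ c ∷ []) (p ∷ q ∷ r ∷ []))
sameOrder-triple a b c p q r _ _ _
  with pairwiseSame a b p q | pairwiseSame a c p r | pairwiseSame b c q r
... | true | true | true = tt

sameOrder-triple-outer : ∀ {a b c p q r} → T (sameOrder (a ∷ b ∷ c ∷ []) (p ∷ q ∷ r ∷ [])) →
                         T (pairwiseSame a c p r)
sameOrder-triple-outer {a} {b} {c} {p} {q} {r} same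
  with pairwiseSame a b p q | pairwiseSame a c p r
... | _     | true  = tt
... | false | false = same
... | true  | false = same

∈-subseqs⁺ : ∀ {s w} → s ⊆ w → s ∈ subseqs w
∈-subseqs⁺ []           = here refl
∈-subseqs⁺ (_ ∷ʳ s⊆w)   = ∈-++⁺ʳ _ (∈-subseqs⁺ s⊆w)
∈-subseqs⁺ (refl ∷ s⊆w) = ∈-++⁺ˡ (∈-map⁺ _ (∈-subseqs⁺ s⊆w))

∈-subseqs⁻ : ∀ w {s} → s ∈ subseqs w → s ⊆ w
∈-subseqs⁻ []      (here refl) = []
∈-subseqs⁻ (y ∷ w) s∈ with ∈-++⁻ (map (y ∷_) (subseqs w)) s∈
... | inj₂ s∈′ = y ∷ʳ ∈-subseqs⁻ w s∈′
... | inj₁ s∈′ with s′ , s′∈ , refl ← ∈-map⁻ (y ∷_) s∈′ = refl ∷ ∈-subseqs⁻ w s′∈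

contains⇔ : ∀ {π σ} → T (contains π σ) ⇔ (∃[ s ] s ⊆ π × T (sameOrder s σ))
contains⇔ {π} = mk⇔
  (λ π∋σ → let s , s∈ , same = find (from any⇔ π∋σ) in s , ∈-subseqs⁻ π s∈ , same)
  (λ (s , s⊆π , same) → to any⇔ (lose (∈-subseqs⁺ s⊆π) same))

-- Pattern avoidance

Π : List (List ℕ)
Π = (2 ∷ 3 ∷ 1 ∷ []) ∷ (3 ∷ 1 ∷ 2 ∷ []) ∷ (3 ∷ 2 ∷ 1 ∷ []) ∷ []

data Falling : List ℕ → Set where
  falling : ∀ {a b c} → c < a → Falling (a ∷ b ∷ c ∷ [])

OuterAscending : List ℕ → Set
OuterAscending w = ∀ {a b c} → a ∷ b ∷ c ∷ [] ⊆ w → a < c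

1<2 : 1 < 2
1<2 = n<1+n 1

2<3 : 2 < 3
2<3 = n<1+n 2

1<3 : 1 < 3
1<3 = <-trans 1<2 2<3

Π-Falling : All Falling Π
Π-Falling = falling 1<2 ∷ falling 2<3 ∷ falling 1<3 ∷ []

sameOrder-Falling : ∀ s {σ} → Falling σ → T (sameOrder s σ) → Falling s
sameOrder-Falling (a ∷ b ∷ c ∷ []) (falling {b = q} r<p) same =
  falling (pairwiseSame->⁻ r<p (sameOrder-triple-outer {b = b} {q = q} same))
sameOrder-Falling []                          (falling _) ()
sameOrder-Falling (_ ∷ [])                    (falling _) ()
sameOrder-Falling s@(_ ∷ _ ∷ [])        {σ} (falling _) same with () ← sameOrder-length s σ same
sameOrder-Falling s@(_ ∷ _ ∷ _ ∷ _ ∷ _) {σ} (falling _) same with () ← sameOrder-length s σ same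

Falling-matches-Π : ∀ {a b c} → Unique (a ∷ b ∷ c ∷ []) → c < a → Any (T ∘ sameOrder (a ∷ b ∷ c ∷ [])) Π
Falling-matches-Π {a} {b} {c} ((a≢b ∷ _) ∷ (b≢c ∷ []) ∷ _) c<a with <-cmp a b
... | tri< a<b _ _ = here (sameOrder-triple a b c 2 3 1
        (pairwiseSame-< a<b 2<3) (pairwiseSame-> c<a 1<2) (pairwiseSame-> (<-trans c<a a<b) 1<3))
... | tri≈ _ a≡b _ = contradiction a≡b a≢b
... | tri> _ _ b<a with <-cmp b c
...   | tri< b<c _ _ = there (here (sameOrder-triple a b c 3 1 2
          (pairwiseSame-> b<a 1<3) (pairwiseSame-> c<a 2<3) (pairwiseSame-< b<c 1<2)))
...   | tri≈ _ b≡c _ = contradiction b≡c b≢c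
...   | tri> _ _ c<b = there (there (here (sameOrder-triple a b c 3 2 1
          (pairwiseSame-> b<a 2<3) (pairwiseSame-> c<a 1<3) (pairwiseSame-> c<b 1<2))))

OuterAscending⇒¬Falling : ∀ {s w} → OuterAscending w → s ⊆ w → ¬ Falling s
OuterAscending⇒¬Falling asc s⊆w (falling c<a) = <⇒≯ (asc s⊆w) c<a

OuterAscending⇒avoidsAll-Π : ∀ {w} → OuterAscending w → T (avoidsAll Π w)
OuterAscending⇒avoidsAll-Π {w} asc = all⁻ (avoids w) (All.map avoid Π-Falling)
  where
  avoid : ∀ {σ} → Falling σ → T (avoids w σ)
  avoid σ↓ = from T-not λ w∋σ →
    let s , s⊆w , same = to contains⇔ w∋σ in OuterAscending⇒¬Falling asc s⊆w (sameOrder-Falling s σ↓ same)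

avoidsAll-Π⇒OuterAscending : ∀ {w} → Unique w → T (avoidsAll Π w) → OuterAscending w
avoidsAll-Π⇒OuterAscending {w} w! avoid {a} {b} {c} abc⊆w with <-cmp a c
... | tri< a<c _ _ = a<c
... | tri≈ _ a≡c _ with (_ ∷ a≢c ∷ []) ∷ _ ← Unique-resp-⊆ abc⊆w w! = contradiction a≡c a≢c
... | tri> _ _ c<a = contradiction
  (Any.map (λ same → from contains⇔ (_ , abc⊆w , same)) (Falling-matches-Π (Unique-resp-⊆ abc⊆w w!) c<a))
  (All¬⇒¬Any (All.map (to T-not) (all⁺ (avoids w) Π avoid)))

-- Permutations as words

elem⇔∈ : ∀ {a xs} → T (elem a xs) ⇔ a ∈ xs
elem⇔∈ {a} = mk⇔ (Any.map (≡ᵇ⇒≡ a _) ∘ from any⇔) (to any⇔ ∘ Any.map (≡⇒≡ᵇ a _))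

distinct⇒Unique : ∀ w → T (distinct w) → Unique w
distinct⇒Unique []      _ = []
distinct⇒Unique (x ∷ w) d =
  let x∉w , w-distinct = to T-∧ d
  in ¬Any⇒All¬ w (to T-not x∉w ∘ from elem⇔∈) ∷ distinct⇒Unique w w-distinct

Unique⇒distinct : ∀ {w} → Unique w → T (distinct w)
Unique⇒distinct []         = tt
Unique⇒distinct (x≢w ∷ w!) = from T-∧ (from T-not (All¬⇒¬Any x≢w ∘ to elem⇔∈) , Unique⇒distinct w!)

alphabet : ℕ → List ℕ
alphabet n = map suc (upTo n)

∈-alphabet⁺ : ∀ {n v} → 0 < v → v ≤ n → v ∈ alphabet n
∈-alphabet⁺ {v = suc i} _ i<n = ∈-map⁺ suc (∈-upTo⁺ i<n)

∈-alphabet⁻ : ∀ {n v} → v ∈ alphabet n → 0 < v × v ≤ n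
∈-alphabet⁻ v∈ with i , i∈ , refl ← ∈-map⁻ suc v∈ = z<s , ∈-upTo⁻ i∈

length-alphabet : ∀ n → length (alphabet n) ≡ n
length-alphabet n = trans (length-map suc (upTo n)) (length-upTo n)

alphabet-unique : ∀ n → Unique (alphabet n)
alphabet-unique n = Unique.map⁺ suc-injective (Unique.upTo⁺ n)

concatMap-map≡cartesianProductWith : ∀ {a b c} {A : Set a} {B : Set b} {C : Set c} (f : A → B → C) xs ys →
                                     concatMap (λ x → map (f x) ys) xs ≡ cartesianProductWith f xs ys
concatMap-map≡cartesianProductWith f []       ys = refl
concatMap-map≡cartesianProductWith f (x ∷ xs) ys =
  cong (map (f x) ys ++_) (concatMap-map≡cartesianProductWith f xs ys)

words-suc : ∀ n k → words n (suc k) ≡ cartesianProductWith (flip _∷_) (words n k) (alphabet n)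
words-suc n k = concatMap-map≡cartesianProductWith (flip _∷_) (words n k) (alphabet n)

∈-words⁺ : ∀ {n w} → All (_∈ alphabet n) w → w ∈ words n (length w)
∈-words⁺ []                    = here refl
∈-words⁺ {n} {a ∷ w} (a∈ ∷ w⊆) rewrite words-suc n (length w) =
  ∈-cartesianProductWith⁺ (flip _∷_) (∈-words⁺ w⊆) a∈

∈-words⁻ : ∀ n k {w} → w ∈ words n k → length w ≡ k × All (_∈ alphabet n) w
∈-words⁻ n zero    (here refl) = refl , []
∈-words⁻ n (suc k) w∈ rewrite words-suc n k
  with u , a , u∈ , a∈ , refl ← ∈-cartesianProductWith⁻ (flip _∷_) (words n k) (alphabet n) w∈
  with |u|≡k , u⊆ ← ∈-words⁻ n k u∈ = cong suc |u|≡k , a∈ ∷ u⊆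

words-unique : ∀ n k → Unique (words n k)
words-unique n zero    = [] ∷ []
words-unique n (suc k) rewrite words-suc n k =
  Unique.cartesianProductWith⁺ (flip _∷_) flip-∷-injective (words-unique n k) (alphabet-unique n)
  where
  flip-∷-injective : ∀ {u v : List ℕ} {a b} → a ∷ u ≡ b ∷ v → u ≡ v × a ≡ b
  flip-∷-injective eq = let a≡b , u≡v = ∷-injective eq in u≡v , a≡b

IsPermutation : ℕ → List ℕ → Set
IsPermutation n w = Unique w × length w ≡ n × All (_∈ alphabet n) w

∈-perms⁺ : ∀ {n w} → IsPermutation n w → w ∈ perms n
∈-perms⁺ (w! , refl , w⊆) = ∈-filter⁺ (T? ∘ distinct) (∈-words⁺ w⊆) (Unique⇒distinct w!)

∈-perms⁻ : ∀ {n w} → w ∈ perms n → IsPermutation n w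
∈-perms⁻ {n} {w} w∈ =
  let w∈words , w-distinct = ∈-filter⁻ (T? ∘ distinct) {xs = words n n} w∈
      |w|≡n , w⊆ = ∈-words⁻ n n w∈words
  in distinct⇒Unique w w-distinct , |w|≡n , w⊆

perms-unique : ∀ n → Unique (perms n)
perms-unique n = Unique.filter⁺ (T? ∘ distinct) (words-unique n n)

-- Layered permutations

-- Direct sums of blocks 1 and 21 on the values m + 1, …, m + length w.
data Layered : ℕ → List ℕ → Set where
  []   : ∀ {m} → Layered m []
  1⊕_  : ∀ {m w} → Layered (suc m) w → Layered m (suc m ∷ w)
  21⊕_ : ∀ {m w} → Layered (suc (suc m)) w → Layered m (suc (suc m) ∷ suc m ∷ w)

Layered-> : ∀ {m w} → Layered m w → All (m <_) w
Layered-> []      = []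
Layered-> (1⊕ L)  = n<1+n _ ∷ All.map (<-trans (n<1+n _)) (Layered-> L)
Layered-> (21⊕ L) = m<n+m _ z<s ∷ n<1+n _ ∷ All.map (<-trans (m<n+m _ z<s)) (Layered-> L)

Layered-≤ : ∀ {m w} → Layered m w → All (_≤ m + length w) w
Layered-≤ []                   = []
Layered-≤ {m} (1⊕_ {w = w} L) rewrite +-suc m (length w) = s≤s (m≤m+n m _) ∷ Layered-≤ L
Layered-≤ {m} (21⊕_ {w = w} L) rewrite +-suc m (suc (length w)) | +-suc m (length w) =
  s≤s (s≤s (m≤m+n m _)) ∷ s≤s (m≤n⇒m≤1+n (m≤m+n m _)) ∷ Layered-≤ L

Layered-unique : ∀ {m w} → Layered m w → Unique w
Layered-unique []      = []
Layered-unique (1⊕ L)  = All.map <⇒≢ (Layered-> L) ∷ Layered-unique L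
Layered-unique (21⊕ L) = (>⇒≢ (n<1+n _) ∷ All.map <⇒≢ (Layered-> L))
                       ∷ All.map (<⇒≢ ∘ <-trans (n<1+n _)) (Layered-> L)
                       ∷ Layered-unique L

Layered-outerAscending : ∀ {m w} → Layered m w → OuterAscending w
Layered-outerAscending (1⊕ L)  (_ ∷ʳ abc⊆w)        = Layered-outerAscending L abc⊆w
Layered-outerAscending (1⊕ L)  (refl ∷ bc⊆w)       = All.lookup (Layered-> L) (lookup bc⊆w (there (here refl)))
Layered-outerAscending (21⊕ L) (_ ∷ʳ _ ∷ʳ abc⊆w)   = Layered-outerAscending L abc⊆w
Layered-outerAscending (21⊕ L) (_ ∷ʳ refl ∷ bc⊆w)  =
  <-trans (n<1+n _) (All.lookup (Layered-> L) (lookup bc⊆w (there (here refl))))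
Layered-outerAscending (21⊕ L) (refl ∷ _ ∷ʳ bc⊆w)  = All.lookup (Layered-> L) (lookup bc⊆w (there (here refl)))
Layered-outerAscending (21⊕ L) (refl ∷ refl ∷ c⊆w) = All.lookup (Layered-> L) (lookup c⊆w (here refl))

Covers : ℕ → List ℕ → Set
Covers m w = ∀ {v} → m < v → v ≤ m + length w → v ∈ w

Covers-least : ∀ {m x w} → Covers m (x ∷ w) → suc m ∈ x ∷ w
Covers-least {m} covers = covers (n<1+n m) (m<m+n m z<s)

Covers-drop : ∀ {m} us w → Covers m (us ++ suc m ∷ w) → Covers (suc m) (us ++ w)
Covers-drop {m} us w covers {v} 1+m<v v≤ =
  ∈-removeMiddle us w (covers (<-trans (n<1+n m) 1+m<v) v≤′) (<⇒≢ 1+m<v)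
  where
  open ≤-Reasoning
  v≤′ : v ≤ m + length (us ++ suc m ∷ w)
  v≤′ = begin
    v                             ≤⟨ v≤ ⟩
    suc m + length (us ++ w)      ≡⟨ +-suc m _ ⟨
    m + suc (length (us ++ w))    ≡⟨ cong (m +_) (↭-length (shift (suc m) us w)) ⟨
    m + length (us ++ suc m ∷ w)  ∎

All-<-suc : ∀ {m w} → All (m <_) w → All (suc m ≢_) w → All (suc m <_) w
All-<-suc m<w 1+m≢w = All.zipWith (λ (m<v , 1+m≢v) → ≤∧≢⇒< m<v 1+m≢v) (m<w , 1+m≢w)

-- m + 1 occurs in w; if not first, it is second (a later occurrence would end a falling triple
-- started by the first two letters), and then m + 2 must be first for the same reason.
layered : ∀ {m w} → Unique w → All (m <_) w → Covers m w → OuterAscending w → Layered m w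
layered {w = []} _ _ _ _ = []
layered {m} {x ∷ w} (x≢w ∷ w!) (m<x ∷ m<w) covers asc with Covers-least covers
... | here refl =
  1⊕ layered w! (All-<-suc m<w x≢w) (Covers-drop [] w covers) (λ abc⊆w → asc (_ ∷ʳ abc⊆w))
layered {m} {x ∷ y ∷ w} _ (m<x ∷ _) _ asc | there (there 1+m∈w) =
  contradiction (asc (refl ∷ refl ∷ from∈ 1+m∈w)) (≤⇒≯ m<x)
layered {m} {x ∷ y ∷ w} ((x≢1+m ∷ x≢w) ∷ 1+m≢w ∷ w!) (m<x ∷ _ ∷ m<w) covers asc | there (here refl)
  with Covers-least (Covers-drop (x ∷ []) w covers)
... | here refl = 21⊕ layered w! (All-<-suc (All-<-suc m<w 1+m≢w) x≢w)
                                 (Covers-drop [] w (Covers-drop (x ∷ []) w covers))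
                                 (λ abc⊆w → asc (_ ∷ʳ _ ∷ʳ abc⊆w))
... | there 2+m∈w = contradiction (≤-antisym (≤-pred (asc (refl ∷ refl ∷ from∈ 2+m∈w))) m<x) x≢1+m

permutation-covers : ∀ {n w} → IsPermutation n w → Covers 0 w
permutation-covers (w! , refl , w⊆) 0<v v≤n =
  unique∧length≥⇒⊇ _≟_ w! w⊆ (≤-reflexive (length-alphabet _)) (∈-alphabet⁺ 0<v v≤n)

permutation-layered : ∀ {n w} → IsPermutation n w → OuterAscending w → Layered 0 w
permutation-layered π@(w! , _ , w⊆) = layered w! (All.map (proj₁ ∘ ∈-alphabet⁻) w⊆) (permutation-covers π)

Layered-permutation : ∀ {w} → Layered 0 w → IsPermutation (length w) w
Layered-permutation L =
  Layered-unique L , refl , All.zipWith (λ (0<v , v≤n) → ∈-alphabet⁺ 0<v v≤n) (Layered-> L , Layered-≤ L)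

layereds : ℕ → ℕ → List (List ℕ)
pairLayereds : ℕ → ℕ → List (List ℕ)

layereds m zero    = [] ∷ []
layereds m (suc k) = map (suc m ∷_) (layereds (suc m) k) ++ pairLayereds m k

pairLayereds m zero    = []
pairLayereds m (suc k) = map (λ w → suc (suc m) ∷ suc m ∷ w) (layereds (suc (suc m)) k)

length-layereds : ∀ m k → length (layereds m k) ≡ fib (suc k)
length-pairLayereds : ∀ m k → length (pairLayereds m k) ≡ fib k

length-layereds m zero    = refl
length-layereds m (suc k) = begin
  length (map (suc m ∷_) (layereds (suc m) k) ++ pairLayereds m k)
    ≡⟨ length-++ (map (suc m ∷_) (layereds (suc m) k)) ⟩
  length (map (suc m ∷_) (layereds (suc m) k)) + length (pairLayereds m k)
    ≡⟨ cong₂ _+_ (length-map _ (layereds (suc m) k)) (length-pairLayereds m k) ⟩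
  length (layereds (suc m) k) + fib k
    ≡⟨ cong (_+ fib k) (length-layereds (suc m) k) ⟩
  fib (suc k) + fib k
    ∎
  where open ≡-Reasoning

length-pairLayereds m zero    = refl
length-pairLayereds m (suc k) =
  trans (length-map _ (layereds (suc (suc m)) k)) (length-layereds (suc (suc m)) k)

∈-layereds⁺ : ∀ {m w} → Layered m w → w ∈ layereds m (length w)
∈-layereds⁺ []                   = here refl
∈-layereds⁺ (1⊕ L)               = ∈-++⁺ˡ (∈-map⁺ _ (∈-layereds⁺ L))
∈-layereds⁺ {m} (21⊕_ {w = w} L) =
  ∈-++⁺ʳ (map (suc m ∷_) (layereds (suc m) (suc (length w)))) (∈-map⁺ _ (∈-layereds⁺ L))

∈-layereds⁻ : ∀ m k {w} → w ∈ layereds m k → Layered m w × length w ≡ k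
∈-layereds⁻ m zero    (here refl) = [] , refl
∈-layereds⁻ m (suc k) w∈ with ∈-++⁻ (map (suc m ∷_) (layereds (suc m) k)) w∈
... | inj₁ w∈₁ with u , u∈ , refl ← ∈-map⁻ _ w∈₁ =
  let L , |u|≡k = ∈-layereds⁻ (suc m) k u∈ in 1⊕ L , cong suc |u|≡k
∈-layereds⁻ m (suc (suc k)) w∈ | inj₂ w∈₂ with u , u∈ , refl ← ∈-map⁻ _ w∈₂ =
  let L , |u|≡k = ∈-layereds⁻ (suc (suc m)) k u∈ in 21⊕ L , cong (suc ∘ suc) |u|≡k

layereds-unique : ∀ m k → Unique (layereds m k)
pairLayereds-unique : ∀ m k → Unique (pairLayereds m k)

layereds-unique m zero    = [] ∷ []
layereds-unique m (suc k) = Unique.++⁺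
  (Unique.map⁺ ∷-injectiveʳ (layereds-unique (suc m) k)) (pairLayereds-unique m k) (heads-differ k)
  where
  heads-differ : ∀ k {v} → v ∈ map (suc m ∷_) (layereds (suc m) k) × v ∈ pairLayereds m k → ⊥
  heads-differ (suc k) (v∈₁ , v∈₂) with _ , _ , refl ← ∈-map⁻ _ v∈₁ | _ , _ , eq ← ∈-map⁻ _ v∈₂ =
    <⇒≢ (n<1+n (suc m)) (∷-injectiveˡ eq)

pairLayereds-unique m zero    = []
pairLayereds-unique m (suc k) = Unique.map⁺ (∷-injectiveʳ ∘ ∷-injectiveʳ) (layereds-unique (suc (suc m)) k)

-- Layered desarrangements

Layered-desarrangement : ∀ {w} → Layered 0 w → T (isDesarrangement w) → ∃[ u ] w ≡ 2 ∷ 1 ∷ u × Layered 2 u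
Layered-desarrangement (21⊕ L)    _  = _ , refl , L
Layered-desarrangement []         ()
Layered-desarrangement (1⊕ [])    ()
Layered-desarrangement (1⊕ 1⊕ _)  ()
Layered-desarrangement (1⊕ 21⊕ _) ()

21⊕-desarrangement : ∀ {u} → Layered 2 u → T (isDesarrangement (2 ∷ 1 ∷ u))
21⊕-desarrangement []      = tt
21⊕-desarrangement (1⊕ _)  = tt
21⊕-desarrangement (21⊕ _) = tt

isDesarrangementAvoidingΠ : List ℕ → Bool
isDesarrangementAvoidingΠ π = isDesarrangement π ∧ avoidsAll Π π

desarrangementsAvoidingΠ : ℕ → List (List ℕ)
desarrangementsAvoidingΠ n = filter (T? ∘ isDesarrangementAvoidingΠ) (perms n)

desarrangementsAvoidingΠ-unique : ∀ n → Unique (desarrangementsAvoidingΠ n)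
desarrangementsAvoidingΠ-unique n = Unique.filter⁺ (T? ∘ isDesarrangementAvoidingΠ) (perms-unique n)

21⊕layereds : ℕ → List (List ℕ)
21⊕layereds k = map (λ u → 2 ∷ 1 ∷ u) (layereds 2 k)

21⊕layereds-unique : ∀ k → Unique (21⊕layereds k)
21⊕layereds-unique k = Unique.map⁺ (∷-injectiveʳ ∘ ∷-injectiveʳ) (layereds-unique 2 k)

∈-desarrangementsAvoidingΠ⁻ : ∀ k {w} → w ∈ desarrangementsAvoidingΠ (suc (suc k)) → w ∈ 21⊕layereds k
∈-desarrangementsAvoidingΠ⁻ k w∈
  with w∈perms , good ← ∈-filter⁻ (T? ∘ isDesarrangementAvoidingΠ) {xs = perms (suc (suc k))} w∈
  with desarrangement , avoid ← to T-∧ good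
  with π@(w! , |w|≡2+k , _) ← ∈-perms⁻ {suc (suc k)} w∈perms
  with u , refl , L ← Layered-desarrangement (permutation-layered π (avoidsAll-Π⇒OuterAscending w! avoid))
                                             desarrangement
  = ∈-map⁺ _ (subst (λ j → u ∈ layereds 2 j) (suc-injective (suc-injective |w|≡2+k)) (∈-layereds⁺ L))

∈-desarrangementsAvoidingΠ⁺ : ∀ k {w} → w ∈ 21⊕layereds k → w ∈ desarrangementsAvoidingΠ (suc (suc k))
∈-desarrangementsAvoidingΠ⁺ k w∈
  with u , u∈ , refl ← ∈-map⁻ _ w∈
  with L , refl ← ∈-layereds⁻ 2 k u∈
  = ∈-filter⁺ (T? ∘ isDesarrangementAvoidingΠ) (∈-perms⁺ {suc (suc k)} (Layered-permutation (21⊕ L)))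
              (from T-∧ (21⊕-desarrangement L , OuterAscending⇒avoidsAll-Π (Layered-outerAscending (21⊕ L))))

theorem3p27 : ∀ (n : ℕ) → n ≥ 1 →
    d n ((2 ∷ 3 ∷ 1 ∷ []) ∷ (3 ∷ 1 ∷ 2 ∷ []) ∷ (3 ∷ 2 ∷ 1 ∷ []) ∷ []) ≡ fib (n Data.Nat.∸ 1)
theorem3p27 (suc zero)    _ = refl
theorem3p27 (suc (suc k)) _ = begin
  length (desarrangementsAvoidingΠ (suc (suc k)))
    ≡⟨ unique⇒length≡ (desarrangementsAvoidingΠ-unique (suc (suc k))) (21⊕layereds-unique k)
                      (All.tabulate (∈-desarrangementsAvoidingΠ⁻ k))
                      (All.tabulate (∈-desarrangementsAvoidingΠ⁺ k)) ⟩
  length (21⊕layereds k)  ≡⟨ length-map _ (layereds 2 k) ⟩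
  length (layereds 2 k)   ≡⟨ length-layereds 2 k ⟩
  fib (suc k)             ∎
  where open ≡-Reasoning
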